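{- Let $n$ be a positive integer, let $A=\begin{bmatrix}1&2\\0&1\end{bmatrix}$, $B=\begin{bmatrix}1&0\\2&1\end{bmatrix}$, let $\Gamma(2)\subset\mathrm{PSL}_2(\mathbb{Z})$ be the group generated by $A,B$, and let $\Phi(n)$ be the subgroup of $\Gamma(2)$ generated by $A^n$, $B^n$ and the commutator subgroup $\Gamma(2)'$. Let $\pi:\bar{\mathfrak{H}}\to\bar{\mathfrak{H}}/\Phi(n)=X_{\Phi(n)}$ be the quotient map, where $\bar{\mathfrak{H}}=\mathfrak{H}\cup\mathbb{P}^1(\mathbb{Q})$ with the action by fractional linear transformations. Then (1) the actions of $A$ and $B$ on $X_{\Phi(n)}$ commute; (2) $\pi(A^k.1)=\pi(B^k.1)$ for every $k\in\mathbb{Z}$. -}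

module Defs where

open import Data.Nat using (ℕ; zero; suc)
open import Data.Integer using (ℤ; +_; -[1+_]; _+_; _*_; _-_; -_; 0ℤ; 1ℤ)
open import Data.Integer.Properties using (*-identityˡ)
open import Data.Product using (Σ; ∃; _×_; _,_)
open import Relation.Binary.PropositionalEquality using (_≡_; refl; sym; trans; cong₂)
open import Data.Integer.Tactic.RingSolver using (solve-∀)

-- SL₂(ℤ): 2×2 integer matrices [[a , b] , [c , d]] with determinant 1.
-- PSL₂(ℤ) = SL₂(ℤ)/{±I}; we work in SL₂(ℤ) and make -I act trivially
-- and belong to every subgroup considered (i.e. we use preimages).

record SL2 : Set where
  constructor mat
  field
    a b c d : ℤ
    det : a * d - b * c ≡ 1ℤ
open SL2 public

private
  det-mul : ∀ a b c d e f g h →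
    (a * e + b * g) * (c * f + d * h) - (a * f + b * h) * (c * e + d * g)
      ≡ (a * d - b * c) * (e * h - f * g)
  det-mul = solve-∀

  det-inv : ∀ a b c d → d * a - (- b) * (- c) ≡ a * d - b * c
  det-inv = solve-∀

_·_ : SL2 → SL2 → SL2
mat a b c d p · mat e f g h q =
  mat (a * e + b * g) (a * f + b * h) (c * e + d * g) (c * f + d * h)
      (trans (det-mul a b c d e f g h)
        (trans (cong₂ _*_ p q) (*-identityˡ 1ℤ)))

inv : SL2 → SL2
inv (mat a b c d p) = mat d (- b) (- c) a (trans (det-inv a b c d) p)

I : SL2
I = mat 1ℤ 0ℤ 0ℤ 1ℤ refl

-I : SL2
-I = mat (- 1ℤ) 0ℤ 0ℤ (- 1ℤ) refl

A : SL2
A = mat 1ℤ (+ 2) 0ℤ 1ℤ refl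

B : SL2
B = mat 1ℤ 0ℤ (+ 2) 1ℤ refl

_^_ : SL2 → ℕ → SL2
g ^ zero = I
g ^ suc n = g · (g ^ n)

_^ℤ_ : SL2 → ℤ → SL2
g ^ℤ (+ n) = g ^ n
g ^ℤ -[1+ n ] = inv g ^ suc n

[_,_] : SL2 → SL2 → SL2
[ g , h ] = ((g · h) · inv g) · inv h

-- Γ(2): the subgroup generated by A and B (in PSL₂(ℤ); here its
-- preimage in SL₂(ℤ), so -I is included).

data Γ2 : SL2 → Set where
  Γ-A   : Γ2 A
  Γ-B   : Γ2 B
  Γ-neg : Γ2 -I
  Γ-id  : Γ2 I
  Γ-mul : ∀ {g h} → Γ2 g → Γ2 h → Γ2 (g · h)
  Γ-inv : ∀ {g} → Γ2 g → Γ2 (inv g)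

-- Φ(n): the subgroup of Γ(2) generated by Aⁿ, Bⁿ and the commutator
-- subgroup Γ(2)' (again as a preimage in SL₂(ℤ)).

data Φ (n : ℕ) : SL2 → Set where
  Φ-An   : Φ n (A ^ n)
  Φ-Bn   : Φ n (B ^ n)
  Φ-comm : ∀ {g h} → Γ2 g → Γ2 h → Φ n [ g , h ]
  Φ-neg  : Φ n -I
  Φ-id   : Φ n I
  Φ-mul  : ∀ {g h} → Φ n g → Φ n h → Φ n (g · h)
  Φ-inv  : ∀ {g} → Φ n g → Φ n (inv g)

-- A set with a (left) action of PSL₂(ℤ), e.g. the extended upper
-- half plane 𝔥 ∪ ℙ¹(ℚ) with fractional linear transformations.

record PSL2Set : Set₁ where
  field
    X       : Set
    act     : SL2 → X → X
    act-id  : ∀ x → act I x ≡ x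
    act-mul : ∀ g h x → act (g · h) x ≡ act g (act h x)
    act-neg : ∀ x → act -I x ≡ x
open PSL2Set public

-- π x ≡ π y in the quotient X/Φ(n)
SameΦOrbit : (n : ℕ) (S : PSL2Set) → X S → X S → Set
SameΦOrbit n S x y = Σ SL2 λ g → Φ n g × act S g x ≡ y

-- ℙ¹(ℚ): a point p/q is represented by (p , q) ∈ ℤ² ∖ {0};
-- γ = [[a,b],[c,d]] sends p/q to (ap+bq)/(cp+dq).

actV : SL2 → ℤ × ℤ → ℤ × ℤ
actV (mat a b c d _) (p , q) = (a * p + b * q , c * p + d * q)

_≈ℙ_ : ℤ × ℤ → ℤ × ℤ → Set
(p , q) ≈ℙ (p' , q') = p * q' ≡ p' * q

one : ℤ × ℤ
one = (1ℤ , 1ℤ)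

-- π x ≡ π y in ℙ¹(ℚ)/Φ(n) ⊆ X_Φ(n)
SameΦCusp : ℕ → ℤ × ℤ → ℤ × ℤ → Set
SameΦCusp n x y = Σ SL2 λ g → Φ n g × (actV g x ≈ℙ y)

-- Since Φ(n) contains the commutator subgroup Γ(2)', it is normal in Γ(2) and
-- elements of Γ(2) commute as maps on the Φ(n)-orbits of any set with an
-- SL₂(ℤ)-action; this is (1). For (2), the cusp 1 satisfies A⁻¹.1 = -B⁻¹.1,
-- so A⁻¹.1 and B⁻¹.1 lie in one Φ(n)-orbit because -I ∈ Φ(n). Commutativity
-- modulo Φ(n) turns this into A.1 ~ B.1, and then inductively into
-- Aᵏ.1 ~ Bᵏ.1 for all k ∈ ℤ.
module Submission where

open import Defs
open import Data.Nat using (ℕ; _≤_; zero; suc)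
open import Data.Integer using (ℤ; +_; -[1+_]; _+_; _*_; _-_; -_; 0ℤ; 1ℤ)
open import Data.Integer.Properties using (_≟_; neg-involutive)
open import Data.Integer.Tactic.RingSolver using (solve-∀)
open import Data.Product using (_×_; _,_; Σ)
open import Relation.Binary.Bundles using (Setoid)
open import Relation.Binary.PropositionalEquality
  using (_≡_; refl; sym; trans; cong; cong₂; subst; module ≡-Reasoning)
import Relation.Binary.Reasoning.Setoid as SetoidReasoning
open import Axiom.UniquenessOfIdentityProofs using (module Decidable⇒UIP)

SL2-ext : ∀ {g h} → a g ≡ a h → b g ≡ b h → c g ≡ c h → d g ≡ d h → g ≡ h
SL2-ext {mat a b c d p} {mat _ _ _ _ q} refl refl refl refl =
  cong (mat a b c d) (Decidable⇒UIP.≡-irrelevant _≟_ p q)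

inverseˡ : ∀ g → inv g · g ≡ I
inverseˡ (mat a b c d p) =
  SL2-ext (trans (upper-left a b c d) p) (upper-right d b)
          (lower-left c a) (trans (lower-right a b c d) p)
  where
  upper-left : ∀ a b c d → d * a + (- b) * c ≡ a * d - b * c
  upper-left = solve-∀
  upper-right : ∀ x y → x * y + (- y) * x ≡ 0ℤ
  upper-right = solve-∀
  lower-left : ∀ x y → (- x) * y + y * x ≡ 0ℤ
  lower-left = solve-∀
  lower-right : ∀ a b c d → (- c) * b + a * d ≡ a * d - b * c
  lower-right = solve-∀

inv-involutive : ∀ g → inv (inv g) ≡ g
inv-involutive (mat a b c d p) = SL2-ext refl (neg-involutive b) (neg-involutive c) refl

inverseʳ : ∀ g → g · inv g ≡ I
inverseʳ g = subst (λ h → h · inv g ≡ I) (inv-involutive g) (inverseˡ (inv g))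

Γ2-^ : ∀ {g} m → Γ2 g → Γ2 (g ^ m)
Γ2-^ zero    _  = Γ-id
Γ2-^ (suc m) γg = Γ-mul γg (Γ2-^ m γg)

Γ2-[,] : ∀ {g h} → Γ2 g → Γ2 h → Γ2 [ g , h ]
Γ2-[,] {g} {h} γg γh =
  Γ-mul {(g · h) · inv g} {inv h}
    (Γ-mul {g · h} {inv g} (Γ-mul {g} {h} γg γh) (Γ-inv {g} γg)) (Γ-inv {h} γh)

Φ⊆Γ2 : ∀ {n g} → Φ n g → Γ2 g
Φ⊆Γ2 {n} Φ-An               = Γ2-^ n Γ-A
Φ⊆Γ2 {n} Φ-Bn               = Γ2-^ n Γ-B
Φ⊆Γ2 (Φ-comm {g} {h} γg γh) = Γ2-[,] {g} {h} γg γh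
Φ⊆Γ2 Φ-neg                  = Γ-neg
Φ⊆Γ2 Φ-id                   = Γ-id
Φ⊆Γ2 (Φ-mul {g} {h} φg φh)  = Γ-mul {g} {h} (Φ⊆Γ2 φg) (Φ⊆Γ2 φh)
Φ⊆Γ2 (Φ-inv {g} φg)         = Γ-inv {g} (Φ⊆Γ2 φg)

record SL2Action : Set₁ where
  infixr 5 _▷_
  field
    Carrier    : Set
    _▷_        : SL2 → Carrier → Carrier
    ▷-identity : ∀ x → I ▷ x ≡ x
    ▷-mul      : ∀ g h x → (g · h) ▷ x ≡ g ▷ h ▷ x

PSL2Set⇒SL2Action : PSL2Set → SL2Action
PSL2Set⇒SL2Action S = record
  { Carrier = X S ; _▷_ = act S ; ▷-identity = act-id S ; ▷-mul = act-mul S }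

ℤ²-action : SL2Action
ℤ²-action = record
  { Carrier = ℤ × ℤ ; _▷_ = actV ; ▷-identity = actV-identity ; ▷-mul = actV-mul }
  where
  identityˡ : ∀ p q → 1ℤ * p + 0ℤ * q ≡ p
  identityˡ = solve-∀
  identityʳ : ∀ p q → 0ℤ * p + 1ℤ * q ≡ q
  identityʳ = solve-∀
  actV-identity : ∀ v → actV I v ≡ v
  actV-identity (p , q) = cong₂ _,_ (identityˡ p q) (identityʳ p q)
  assoc : ∀ a b e f g h p q →
    (a * e + b * g) * p + (a * f + b * h) * q ≡ a * (e * p + f * q) + b * (g * p + h * q)
  assoc = solve-∀
  actV-mul : ∀ g h v → actV (g · h) v ≡ actV g (actV h v)
  actV-mul (mat a b c d _) (mat e f g h _) (p , q) =
    cong₂ _,_ (assoc a b e f g h p q) (assoc c d e f g h p q)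

module ActionProperties (𝒜 : SL2Action) where
  open SL2Action 𝒜

  ▷-inverseˡ : ∀ g x → inv g ▷ g ▷ x ≡ x
  ▷-inverseˡ g x = begin
    inv g ▷ g ▷ x   ≡⟨ ▷-mul (inv g) g x ⟨
    (inv g · g) ▷ x ≡⟨ cong (_▷ x) (inverseˡ g) ⟩
    I ▷ x           ≡⟨ ▷-identity x ⟩
    x               ∎
    where open ≡-Reasoning

  ▷-inverseʳ : ∀ g x → g ▷ inv g ▷ x ≡ x
  ▷-inverseʳ g x = begin
    g ▷ inv g ▷ x   ≡⟨ ▷-mul g (inv g) x ⟨
    (g · inv g) ▷ x ≡⟨ cong (_▷ x) (inverseʳ g) ⟩
    I ▷ x           ≡⟨ ▷-identity x ⟩
    x               ∎
    where open ≡-Reasoning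

  ▷-^-comm : ∀ g m x → g ▷ (g ^ m) ▷ x ≡ (g ^ m) ▷ g ▷ x
  ▷-^-comm g zero x = trans (cong (g ▷_) (▷-identity x)) (sym (▷-identity (g ▷ x)))
  ▷-^-comm g (suc m) x = begin
    g ▷ (g · (g ^ m)) ▷ x ≡⟨ cong (g ▷_) (▷-mul g (g ^ m) x) ⟩
    g ▷ g ▷ (g ^ m) ▷ x   ≡⟨ cong (g ▷_) (▷-^-comm g m x) ⟩
    g ▷ (g ^ m) ▷ g ▷ x   ≡⟨ ▷-mul g (g ^ m) (g ▷ x) ⟨
    (g · (g ^ m)) ▷ g ▷ x ∎
    where open ≡-Reasoning

  ▷-[,] : ∀ g h x → [ g , h ] ▷ h ▷ g ▷ x ≡ (g · h) ▷ x
  ▷-[,] g h x = begin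
    [ g , h ] ▷ h ▷ g ▷ x                 ≡⟨ ▷-mul ((g · h) · inv g) (inv h) _ ⟩
    ((g · h) · inv g) ▷ inv h ▷ h ▷ g ▷ x ≡⟨ cong (((g · h) · inv g) ▷_) (▷-inverseˡ h _) ⟩
    ((g · h) · inv g) ▷ g ▷ x             ≡⟨ ▷-mul (g · h) (inv g) _ ⟩
    (g · h) ▷ inv g ▷ g ▷ x               ≡⟨ cong ((g · h) ▷_) (▷-inverseˡ g x) ⟩
    (g · h) ▷ x                           ∎
    where open ≡-Reasoning

  module ΦOrbit (n : ℕ) where

    infix 4 _∼_
    _∼_ : Carrier → Carrier → Set
    x ∼ y = Σ SL2 λ g → Φ n g × g ▷ x ≡ y

    ∼-refl : ∀ {x} → x ∼ x
    ∼-refl {x} = I , Φ-id , ▷-identity x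

    ∼-sym : ∀ {x y} → x ∼ y → y ∼ x
    ∼-sym {x} (g , φg , refl) = inv g , Φ-inv {n} {g} φg , ▷-inverseˡ g x

    ∼-trans : ∀ {x y z} → x ∼ y → y ∼ z → x ∼ z
    ∼-trans {x} (g , φg , refl) (h , φh , refl) = h · g , Φ-mul {n} {h} {g} φh φg , ▷-mul h g x

    ∼-setoid : Setoid _ _
    ∼-setoid = record
      { Carrier = Carrier
      ; _≈_ = _∼_
      ; isEquivalence = record { refl = ∼-refl ; sym = ∼-sym ; trans = ∼-trans }
      }

    ∼-commute : ∀ {g h} → Γ2 g → Γ2 h → ∀ x → g ▷ h ▷ x ∼ h ▷ g ▷ x
    ∼-commute {g} {h} γg γh x =
      [ h , g ] , Φ-comm {n} {h} {g} γh γg , trans (▷-[,] h g x) (▷-mul h g x)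

    -- Φ(n) is normal in Γ(2): γ g γ⁻¹ = [γ , g] g.
    ∼-cong : ∀ {γ x y} → Γ2 γ → x ∼ y → γ ▷ x ∼ γ ▷ y
    ∼-cong {γ} {x} γγ (g , φg , refl) =
      [ γ , g ] · g , Φ-mul {n} {[ γ , g ]} {g} (Φ-comm {n} {γ} {g} γγ (Φ⊆Γ2 φg)) φg , (begin
        ([ γ , g ] · g) ▷ γ ▷ x ≡⟨ ▷-mul [ γ , g ] g _ ⟩
        [ γ , g ] ▷ g ▷ γ ▷ x   ≡⟨ ▷-[,] γ g x ⟩
        (γ · g) ▷ x             ≡⟨ ▷-mul γ g x ⟩
        γ ▷ g ▷ x               ∎)
      where open ≡-Reasoning

    ∼-swap-inverses : ∀ {g h x} → Γ2 g → Γ2 h → inv h ▷ x ∼ inv g ▷ x → g ▷ x ∼ h ▷ x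
    ∼-swap-inverses {g} {h} {x} γg γh h⁻¹x∼g⁻¹x = begin
      g ▷ x                 ≡⟨ cong (g ▷_) (▷-inverseʳ h x) ⟨
      g ▷ h ▷ inv h ▷ x     ≈⟨ ∼-commute γg γh (inv h ▷ x) ⟩
      h ▷ g ▷ inv h ▷ x     ≈⟨ ∼-cong γh (∼-cong γg h⁻¹x∼g⁻¹x) ⟩
      h ▷ g ▷ inv g ▷ x     ≡⟨ cong (h ▷_) (▷-inverseʳ g x) ⟩
      h ▷ x                 ∎
      where open SetoidReasoning ∼-setoid

    ∼-^ : ∀ {g h x} → Γ2 g → Γ2 h → g ▷ x ∼ h ▷ x → ∀ m → (g ^ m) ▷ x ∼ (h ^ m) ▷ x
    ∼-^ γg γh gx∼hx zero = ∼-refl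
    ∼-^ {g} {h} {x} γg γh gx∼hx (suc m) = begin
      (g · (g ^ m)) ▷ x     ≡⟨ ▷-mul g (g ^ m) x ⟩
      g ▷ (g ^ m) ▷ x       ≈⟨ ∼-cong γg (∼-^ γg γh gx∼hx m) ⟩
      g ▷ (h ^ m) ▷ x       ≈⟨ ∼-commute γg (Γ2-^ m γh) x ⟩
      (h ^ m) ▷ g ▷ x       ≈⟨ ∼-cong (Γ2-^ m γh) gx∼hx ⟩
      (h ^ m) ▷ h ▷ x       ≡⟨ ▷-^-comm h m x ⟨
      h ▷ (h ^ m) ▷ x       ≡⟨ ▷-mul h (h ^ m) x ⟨
      (h · (h ^ m)) ▷ x     ∎
      where open SetoidReasoning ∼-setoid

≈ℙ-refl : ∀ v → v ≈ℙ v
≈ℙ-refl (p , q) = refl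

module _ (n : ℕ) where
  open ActionProperties ℤ²-action
  open ΦOrbit n

  -- A⁻¹.1 = (-1 , 1) and B⁻¹.1 = (1 , -1).
  A⁻¹·one∼B⁻¹·one : actV (inv A) one ∼ actV (inv B) one
  A⁻¹·one∼B⁻¹·one = -I , Φ-neg , refl

  Aᵏ·one∼Bᵏ·one : ∀ k → actV (A ^ℤ k) one ∼ actV (B ^ℤ k) one
  Aᵏ·one∼Bᵏ·one (+ m) =
    ∼-^ {x = one} Γ-A Γ-B (∼-swap-inverses {x = one} Γ-A Γ-B (∼-sym A⁻¹·one∼B⁻¹·one)) m
  Aᵏ·one∼Bᵏ·one -[1+ m ] =
    ∼-^ {x = one} (Γ-inv {A} Γ-A) (Γ-inv {B} Γ-B) A⁻¹·one∼B⁻¹·one (suc m)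

  ∼⇒SameΦCusp : ∀ {v w} → v ∼ w → SameΦCusp n v w
  ∼⇒SameΦCusp {v} (g , φg , refl) = g , φg , ≈ℙ-refl (actV g v)

lemma3p1 : (n : ℕ) → 1 ≤ n →
    ((S : PSL2Set) → (x : X S) →
      SameΦOrbit n S (act S A (act S B x)) (act S B (act S A x)))
    × ((k : ℤ) → SameΦCusp n (actV (A ^ℤ k) one) (actV (B ^ℤ k) one))
lemma3p1 n _ =
  (λ S → ActionProperties.ΦOrbit.∼-commute (PSL2Set⇒SL2Action S) n Γ-A Γ-B) ,
  (λ k → ∼⇒SameΦCusp n (Aᵏ·one∼Bᵏ·one n k))
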